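{- Let $P$ be a path with vertex colouring $\omega$ from colour-set $C$, and let $P'$ be the coloured path (with colouring $\omega'$, the restriction of $\omega$) obtained from $P$ by deleting one vertex and joining its neighbours. Then for every $d \in C$, $m(P',\omega',d) \leq m(P,\omega,d)$. Moreover $m(P',\omega') \leq m(P,\omega)$.
   Context: Free-Flood-It: for a graph $G$ with vertex colouring $\omega$ from colour-set $C$, a move $(v,d)$ gives colour $d$ to every vertex of the monochromatic connected component containing $v$ in the current colouring; moves may be played at any vertex. For a connected graph $G$, $m(G,\omega,d)$ denotes the minimum number of moves needed to give all vertices colour $d$, and $m(G,\omega)=\min_{d\in C} m(G,\omega,d)$. -}

module Defs where

open import Data.Nat using (ℕ; zero; suc; _≤_)
open import Data.Fin using (Fin; toℕ; punchIn)
open import Data.Product using (Σ; ∃; _×_; _,_)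
open import Data.Sum using (_⊎_)
open import Relation.Nullary using (¬_)
open import Relation.Binary.PropositionalEquality using (_≡_)

-- A coloured path on n vertices: vertices are Fin n, in order along the path;
-- the colour-set is C = Fin k.
Colouring : ℕ → ℕ → Set
Colouring n k = Fin n → Fin k

PathAdj : {n : ℕ} → Fin n → Fin n → Set
PathAdj i j = (suc (toℕ i) ≡ toℕ j) ⊎ (suc (toℕ j) ≡ toℕ i)

-- w lies in the monochromatic connected component of v under ω
-- (reachable from v by a walk along path edges whose endpoints have equal colour).
data SameComp {n k : ℕ} (ω : Colouring n k) (v : Fin n) : Fin n → Set where
  here : SameComp ω v v
  step : ∀ {u w} → SameComp ω v u → PathAdj u w → ω u ≡ ω w → SameComp ω v w

Move : {n k : ℕ} → Colouring n k → Fin n → Fin k → Colouring n k → Set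
Move ω v d ω' = ∀ x → (SameComp ω v x → ω' x ≡ d) × (¬ SameComp ω v x → ω' x ≡ ω x)

data Moves {n k : ℕ} : Colouring n k → ℕ → Colouring n k → Set where
  done : ∀ {ω} → Moves ω zero ω
  move : ∀ {ω ω₁ ω₂ t} (v : Fin n) (d : Fin k) →
         Move ω v d ω₁ → Moves ω₁ t ω₂ → Moves ω (suc t) ω₂

Floods : {n k : ℕ} → Colouring n k → Fin k → ℕ → Set
Floods ω d t = Σ _ λ ω' → Moves ω t ω' × (∀ x → ω' x ≡ d)

IsMinD : {n k : ℕ} → Colouring n k → Fin k → ℕ → Set
IsMinD ω d m = Floods ω d m × (∀ t → Floods ω d t → m ≤ t)

IsMin : {n k : ℕ} → Colouring n k → ℕ → Set
IsMin {k = k} ω m = (∃ λ (d : Fin k) → Floods ω d m) × (∀ (d : Fin k) t → Floods ω d t → m ≤ t)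

-- Deleting vertex i from the path on suc n vertices and joining its neighbours:
-- the remaining vertices, in order, form the path on n vertices; the colouring is
-- the restriction of ω.
deleteVertex : {n k : ℕ} → Colouring (suc n) k → Fin (suc n) → Colouring n k
deleteVertex ω i j = ω (punchIn i j)

-- Deleting vertex i amounts to first giving i the colour of a neighbour j and then contracting the
-- edge ij, now monochromatic; neither step increases the number of moves needed to flood with d.
-- Contraction: each move on the long path is replayed at a surviving vertex of the same component,
-- and the edge ij stays monochromatic.  Recolouring: call ψ anchored to φ when every ψ-component
-- contains a vertex at which ψ and φ agree.  On a path, agreeing vertices in one φ-component lie
-- in one ψ-component, so a flooding sequence for φ is mirrored in ψ by playing each move at an
-- agreeing vertex of the played component (or a null move if there is none), keeping ψ anchored.

module Submission where

open import Defs
open import Data.Nat using (ℕ; zero; suc; _+_; _∸_; _≤_; _<_; z≤n; _≤?_)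
open import Data.Nat.Properties
  using (≤-refl; ≤-trans; ≤-reflexive; ≤-total; ≤-antisym; ≤-pred; <⇒≤; ≤∧≢⇒<;
         m≤n⇒m≤1+n; m≤n⇒m<n∨m≡n; n≤1+n; m≤m+n; +-suc; +-identityʳ; m+[n∸m]≡n)
open import Data.Fin as Fin using (Fin; toℕ; fromℕ<; punchIn; punchOut)
open import Data.Fin.Properties
  using (toℕ-injective; toℕ<n; toℕ-fromℕ<; punchInᵢ≢i; punchIn-punchOut;
         punchIn-mono-≤; punchIn-cancel-≤; any?; all?)
  renaming (_≟_ to _≟ᶠ_)
open import Data.Vec.Functional using (updateAt)
open import Data.Vec.Functional.Properties using (updateAt-updates; updateAt-minimal)
open import Data.Product using (∃; _×_; _,_; proj₁; proj₂)
open import Data.Sum using (_⊎_; inj₁; inj₂)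
open import Data.Empty using (⊥-elim)
open import Function using (const)
open import Relation.Nullary using (¬_; Dec; yes; no)
open import Relation.Nullary.Decidable using (_×-dec_; _⊎-dec_; _→-dec_; map′)
open import Relation.Binary.PropositionalEquality
  using (_≡_; _≢_; refl; sym; trans; cong; subst)

private
  variable
    n k t : ℕ
    a b m p q r : ℕ
    c d : Fin k
    u v w x y : Fin n
    φ φ' ψ : Colouring n k

Adjacent : ℕ → ℕ → Set
Adjacent a b = suc a ≡ b ⊎ suc b ≡ a

adjacent-sym : Adjacent a b → Adjacent b a
adjacent-sym (inj₁ e) = inj₂ e
adjacent-sym (inj₂ e) = inj₁ e

Between : ℕ → ℕ → ℕ → Set
Between a m b = (a ≤ m × m ≤ b) ⊎ (b ≤ m × m ≤ a)

between-sym : Between a m b → Between b m a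
between-sym (inj₁ ab) = inj₂ ab
between-sym (inj₂ ba) = inj₁ ba

between? : ∀ a m b → Dec (Between a m b)
between? a m b = (a ≤? m ×-dec m ≤? b) ⊎-dec (b ≤? m ×-dec m ≤? a)

between-step : Between a m b → Adjacent p b → m ≡ b ⊎ Between a m p
between-step (inj₁ (a≤m , m≤b)) (inj₁ refl) with m≤n⇒m<n∨m≡n m≤b
... | inj₁ m<b = inj₂ (inj₁ (a≤m , ≤-pred m<b))
... | inj₂ m≡b = inj₁ m≡b
between-step (inj₁ (a≤m , m≤b)) (inj₂ refl) = inj₂ (inj₁ (a≤m , m≤n⇒m≤1+n m≤b))
between-step (inj₂ (b≤m , m≤a)) (inj₁ refl) = inj₂ (inj₂ (<⇒≤ b≤m , m≤a))
between-step (inj₂ (b≤m , m≤a)) (inj₂ refl) with m≤n⇒m<n∨m≡n b≤m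
... | inj₁ b<m = inj₂ (inj₂ (b<m , m≤a))
... | inj₂ b≡m = inj₁ (sym b≡m)

between-adjacent : Between p m q → m ≢ p → m ≢ q → Adjacent r m → Between p r q
between-adjacent (inj₁ (p≤m , m≤q)) m≢p _ (inj₁ refl) =
  inj₁ (≤-pred (≤∧≢⇒< p≤m (λ e → m≢p (sym e))) , <⇒≤ m≤q)
between-adjacent (inj₁ (p≤m , m≤q)) _ m≢q (inj₂ refl) =
  inj₁ (m≤n⇒m≤1+n p≤m , ≤∧≢⇒< m≤q m≢q)
between-adjacent (inj₂ (q≤m , m≤p)) _ m≢q (inj₁ refl) =
  inj₂ (≤-pred (≤∧≢⇒< q≤m (λ e → m≢q (sym e))) , <⇒≤ m≤p)
between-adjacent (inj₂ (q≤m , m≤p)) m≢p _ (inj₂ refl) =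
  inj₂ (m≤n⇒m≤1+n q≤m , ≤∧≢⇒< m≤p m≢p)

between-outside : Between a m b → ¬ Between m a r → ¬ Between m b r → Between a r b
between-outside {a} {b = b} {r} (inj₁ (a≤m , m≤b)) ¬mar ¬mbr with ≤-total r a | ≤-total b r
... | inj₁ r≤a | _        = ⊥-elim (¬mar (inj₂ (r≤a , a≤m)))
... | inj₂ _   | inj₁ b≤r = ⊥-elim (¬mbr (inj₁ (m≤b , b≤r)))
... | inj₂ a≤r | inj₂ r≤b = inj₁ (a≤r , r≤b)
between-outside {a} {b = b} {r} (inj₂ (b≤m , m≤a)) ¬mar ¬mbr with ≤-total r b | ≤-total a r
... | inj₁ r≤b | _        = ⊥-elim (¬mbr (inj₂ (r≤b , b≤m)))
... | inj₂ _   | inj₁ a≤r = ⊥-elim (¬mar (inj₁ (m≤a , a≤r)))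
... | inj₂ b≤r | inj₂ r≤a = inj₂ (b≤r , r≤a)

sameComp-colour : SameComp φ v x → φ x ≡ φ v
sameComp-colour here = refl
sameComp-colour (step s _ e) = trans (sym e) (sameComp-colour s)

sameComp-trans : SameComp φ u v → SameComp φ v w → SameComp φ u w
sameComp-trans s here = s
sameComp-trans s (step s' adj e) = step (sameComp-trans s s') adj e

sameComp-sym : SameComp φ v x → SameComp φ x v
sameComp-sym here = here
sameComp-sym (step s adj e) = sameComp-trans (step here (adjacent-sym adj) (sym e)) (sameComp-sym s)

Monochromatic : Colouring n k → Fin n → Fin n → Set
Monochromatic φ v x = ∀ z → Between (toℕ v) (toℕ z) (toℕ x) → φ z ≡ φ v

sameComp⇒monochromatic : SameComp φ v x → Monochromatic φ v x
sameComp⇒monochromatic {φ = φ} here z (inj₁ (v≤z , z≤v)) = cong φ (toℕ-injective (≤-antisym z≤v v≤z))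
sameComp⇒monochromatic {φ = φ} here z (inj₂ (v≤z , z≤v)) = cong φ (toℕ-injective (≤-antisym z≤v v≤z))
sameComp⇒monochromatic {φ = φ} (step s adj e) z vzw with between-step vzw adj
... | inj₁ z≡w = trans (cong φ (toℕ-injective z≡w)) (sameComp-colour (step s adj e))
... | inj₂ vzu = sameComp⇒monochromatic s z vzu

sameComp-rightward : ∀ gap → toℕ v + gap ≡ toℕ x →
  (∀ z → toℕ v ≤ toℕ z → toℕ z ≤ toℕ x → φ z ≡ φ v) → SameComp φ v x
sameComp-rightward {v = v} zero e _ =
  subst (SameComp _ v) (toℕ-injective (trans (sym (+-identityʳ (toℕ v))) e)) here
sameComp-rightward {n} {v = v} {x} {φ} (suc gap) e mono =
  step (sameComp-rightward gap (sym toℕ-x') (λ z v≤z z≤x' → mono z v≤z (≤-trans z≤x' x'≤x)))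
       (inj₁ x'~x) (trans (mono x' v≤x' x'≤x) (sym (mono x (≤-trans v≤x' x'≤x) ≤-refl)))
  where
  x'<n : toℕ v + gap < n
  x'<n = ≤-trans (≤-reflexive (trans (sym (+-suc (toℕ v) gap)) e)) (<⇒≤ (toℕ<n x))
  x' : Fin n
  x' = fromℕ< x'<n
  toℕ-x' : toℕ x' ≡ toℕ v + gap
  toℕ-x' = toℕ-fromℕ< x'<n
  x'~x : suc (toℕ x') ≡ toℕ x
  x'~x = trans (cong suc toℕ-x') (trans (sym (+-suc (toℕ v) gap)) e)
  v≤x' : toℕ v ≤ toℕ x'
  v≤x' = ≤-trans (m≤m+n (toℕ v) gap) (≤-reflexive (sym toℕ-x'))
  x'≤x : toℕ x' ≤ toℕ x
  x'≤x = ≤-trans (n≤1+n (toℕ x')) (≤-reflexive x'~x)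

monochromatic⇒sameComp : Monochromatic φ v x → SameComp φ v x
monochromatic⇒sameComp {v = v} {x} mono with ≤-total (toℕ v) (toℕ x)
... | inj₁ v≤x = sameComp-rightward (toℕ x ∸ toℕ v) (m+[n∸m]≡n v≤x)
      (λ z v≤z z≤x → mono z (inj₁ (v≤z , z≤x)))
... | inj₂ x≤v = sameComp-sym (sameComp-rightward (toℕ v ∸ toℕ x) (m+[n∸m]≡n x≤v)
      (λ z x≤z z≤v → trans (mono z (inj₂ (x≤z , z≤v))) (sym (mono x (inj₂ (≤-refl , x≤v))))))

sameComp? : (φ : Colouring n k) → ∀ v x → Dec (SameComp φ v x)
sameComp? φ v x = map′ monochromatic⇒sameComp sameComp⇒monochromatic
  (all? λ z → between? (toℕ v) (toℕ z) (toℕ x) →-dec (φ z ≟ᶠ φ v))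

play : Colouring n k → Fin n → Fin k → Colouring n k
play φ v c x with sameComp? φ v x
... | yes _ = c
... | no  _ = φ x

move-play : (φ : Colouring n k) (v : Fin n) (c : Fin k) → Move φ v c (play φ v c)
move-play φ v c x with sameComp? φ v x
... | yes vx = const refl , λ ¬vx → ⊥-elim (¬vx vx)
... | no ¬vx = (λ vx → ⊥-elim (¬vx vx)) , const refl

move-own-colour : Move φ v (φ v) φ
move-own-colour x = sameComp-colour , const refl

move-inside : Move φ v c φ' → SameComp φ v x → SameComp φ' v x
move-inside mv here = here
move-inside mv (step s adj e) =
  step (move-inside mv s) adj (trans (proj₁ (mv _) s) (sym (proj₁ (mv _) (step s adj e))))

move-outside : Move φ v c φ' → ¬ SameComp φ v x → SameComp φ x y → SameComp φ' x y
move-outside mv ¬vx here = here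
move-outside {φ = φ} {v = v} mv ¬vx (step {u} {w} s adj e) =
  step (move-outside mv ¬vx s) adj (trans (proj₂ (mv u) ¬vu) (trans e (sym (proj₂ (mv w) ¬vw))))
  where
  ¬vu : ¬ SameComp φ v u
  ¬vu vu = ¬vx (sameComp-trans vu (sameComp-sym s))
  ¬vw : ¬ SameComp φ v w
  ¬vw vw = ¬vx (sameComp-trans vw (sameComp-sym (step s adj e)))

move-sameComp-colour : Move φ v c φ' → SameComp φ x y → φ' x ≡ φ' y
move-sameComp-colour {φ = φ} {v} {x = x} mv xy with sameComp? φ v x
... | yes vx = trans (proj₁ (mv x) vx) (sym (proj₁ (mv _) (sameComp-trans vx xy)))
... | no ¬vx = trans (proj₂ (mv x) ¬vx)
      (trans (sym (sameComp-colour xy))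
             (sym (proj₂ (mv _) λ vy → ¬vx (sameComp-trans vy (sameComp-sym xy)))))

floods-step : ∀ v c → Move φ v c ψ → Floods ψ d t → Floods φ d (suc t)
floods-step v c mv (φ' , ms , flooded) = φ' , move v c mv ms , flooded

Anchored : Colouring n k → Colouring n k → Set
Anchored φ ψ = ∀ x → ∃ λ y → SameComp ψ x y × ψ y ≡ φ y

-- A vertex z between x and y with ψ z ≢ ψ x has its anchor w strictly on the x..y side (else x or
-- y would share z's monochromatic ψ-interval), where φ w = φ x = ψ x; but ψ z = ψ w = φ w.
anchored-sameComp : Anchored φ ψ → SameComp φ x y → ψ x ≡ φ x → ψ y ≡ φ y → SameComp ψ x y
anchored-sameComp {φ = φ} {ψ} {x} {y} anchored xy ψx ψy = monochromatic⇒sameComp mono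
  where
  mono : Monochromatic ψ x y
  mono z xzy with ψ z ≟ᶠ ψ x | anchored z
  ... | yes ψz≡ψx | _ = ψz≡ψx
  ... | no ψz≢ψx | (w , zw , ψw) = ⊥-elim (ψz≢ψx (trans (sym (sameComp-colour zw))
                     (trans ψw (trans (sameComp⇒monochromatic xy w xwy) (sym ψx)))))
    where
    xwy : Between (toℕ x) (toℕ w) (toℕ y)
    xwy = between-outside xzy
      (λ zxw → ψz≢ψx (sym (sameComp⇒monochromatic zw x zxw)))
      (λ zyw → ψz≢ψx (trans (sym (sameComp⇒monochromatic zw y zyw))
                       (trans ψy (trans (sameComp-colour xy) (sym ψx)))))

floods-anchored : Anchored φ ψ → Floods φ d t → Floods ψ d t
floods-anchored {ψ = ψ} anchored (φ' , done , flooded) = ψ , done , λ x →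
  let (y , xy , ψy) = anchored x in trans (sym (sameComp-colour xy)) (trans ψy (flooded y))
floods-anchored {φ = φ} {ψ} anchored (φ' , move {ω₁ = φ₁} v c mv ms , flooded)
  with any? (λ y → sameComp? φ v y ×-dec (ψ y ≟ᶠ φ y))
... | no ¬hit = floods-step v (ψ v) move-own-colour (floods-anchored anchored₁ (φ' , ms , flooded))
  where
  anchored₁ : Anchored φ₁ ψ
  anchored₁ x = let (y , xy , ψy) = anchored x in
    y , xy , trans ψy (sym (proj₂ (mv y) λ vy → ¬hit (y , vy , ψy)))
... | yes (y₀ , vy₀ , ψy₀) = floods-step y₀ c played (floods-anchored anchored₁ (φ' , ms , flooded))
  where
  played : Move ψ y₀ c (play ψ y₀ c)
  played = move-play ψ y₀ c
  anchored₁ : Anchored φ₁ (play ψ y₀ c)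
  anchored₁ x with sameComp? ψ y₀ x | anchored x
  ... | yes y₀x | _ = y₀ , sameComp-sym (move-inside played y₀x) ,
                  trans (proj₁ (played y₀) here) (sym (proj₁ (mv y₀) vy₀))
  ... | no ¬y₀x | (y , xy , ψy) = y , move-outside played ¬y₀x xy ,
                  trans (proj₂ (played y) ¬y₀y) (trans ψy (sym (proj₂ (mv y) ¬vy)))
    where
    ¬y₀y : ¬ SameComp ψ y₀ y
    ¬y₀y y₀y = ¬y₀x (sameComp-trans y₀y (sameComp-sym xy))
    ¬vy : ¬ SameComp φ v y
    ¬vy vy = ¬y₀y (anchored-sameComp anchored (sameComp-trans (sameComp-sym vy₀) vy) ψy₀ ψy)

between-punchIn : ∀ (i : Fin (suc n)) →
  Between (toℕ u) (toℕ v) (toℕ w) → Between (toℕ (punchIn i u)) (toℕ (punchIn i v)) (toℕ (punchIn i w))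
between-punchIn i (inj₁ (u≤v , v≤w)) = inj₁ (punchIn-mono-≤ i _ _ u≤v , punchIn-mono-≤ i _ _ v≤w)
between-punchIn i (inj₂ (w≤v , v≤u)) = inj₂ (punchIn-mono-≤ i _ _ w≤v , punchIn-mono-≤ i _ _ v≤u)

between-punchIn⁻¹ : ∀ (i : Fin (suc n)) →
  Between (toℕ (punchIn i u)) (toℕ (punchIn i v)) (toℕ (punchIn i w)) → Between (toℕ u) (toℕ v) (toℕ w)
between-punchIn⁻¹ i (inj₁ (u≤v , v≤w)) = inj₁ (punchIn-cancel-≤ i _ _ u≤v , punchIn-cancel-≤ i _ _ v≤w)
between-punchIn⁻¹ i (inj₂ (w≤v , v≤u)) = inj₂ (punchIn-cancel-≤ i _ _ w≤v , punchIn-cancel-≤ i _ _ v≤u)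

sameComp-deleteVertex : ∀ {φ : Colouring (suc n) k} i →
  SameComp φ (punchIn i u) (punchIn i v) → SameComp (deleteVertex φ i) u v
sameComp-deleteVertex i s = monochromatic⇒sameComp λ z uzv →
  sameComp⇒monochromatic s (punchIn i z) (between-punchIn i uzv)

module Contraction {n k : ℕ} (i : Fin (suc n)) (j : Fin n) (i~j : PathAdj i (punchIn i j)) where

  module _ {φ : Colouring (suc n) k} (φi≡φj : φ i ≡ φ (punchIn i j)) where

    sameComp-punchIn : SameComp (deleteVertex φ i) u v → SameComp φ (punchIn i u) (punchIn i v)
    sameComp-punchIn {u} {v} s = monochromatic⇒sameComp mono
      where
      i≢punchIn : ∀ x → toℕ i ≢ toℕ (punchIn i x)
      i≢punchIn x e = punchInᵢ≢i i x (toℕ-injective (sym e))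
      mono : Monochromatic φ (punchIn i u) (punchIn i v)
      mono z uzv with z ≟ᶠ i
      ... | yes refl = trans φi≡φj (sameComp⇒monochromatic s j
            (between-punchIn⁻¹ i (between-adjacent uzv (i≢punchIn u) (i≢punchIn v) (adjacent-sym i~j))))
      ... | no z≢i = subst (λ z → φ z ≡ φ (punchIn i u)) (punchIn-punchOut i≢z)
            (sameComp⇒monochromatic s (punchOut i≢z) (between-punchIn⁻¹ i
              (subst (λ z → Between (toℕ (punchIn i u)) (toℕ z) (toℕ (punchIn i v)))
                     (sym (punchIn-punchOut i≢z)) uzv)))
        where
        i≢z : i ≢ z
        i≢z i≡z = z≢i (sym i≡z)

    survivor : ∀ v → ∃ λ v' → SameComp φ v (punchIn i v')
    survivor v with v ≟ᶠ i
    ... | yes refl = j , step here i~j φi≡φj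
    ... | no v≢i = punchOut (λ i≡v → v≢i (sym i≡v)) , subst (SameComp φ v) (sym (punchIn-punchOut _)) here

  floods-contract : {φ : Colouring (suc n) k} → φ i ≡ φ (punchIn i j) →
    Floods φ d t → Floods (deleteVertex φ i) d t
  floods-contract φi≡φj (φ' , done , flooded) = deleteVertex φ' i , done , λ x → flooded (punchIn i x)
  floods-contract {φ = φ} φi≡φj (φ' , move {ω₁ = φ₁} v c mv ms , flooded) with survivor φi≡φj v
  ... | (v' , vv') = floods-step v' c move' (floods-contract φ₁i≡φ₁j (φ' , ms , flooded))
    where
    move' : Move (deleteVertex φ i) v' c (deleteVertex φ₁ i)
    move' x =
      (λ v'x → proj₁ (mv (punchIn i x)) (sameComp-trans vv' (sameComp-punchIn φi≡φj v'x))) ,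
      (λ ¬v'x → proj₂ (mv (punchIn i x)) λ vx →
         ¬v'x (sameComp-deleteVertex i (sameComp-trans (sameComp-sym vv') vx)))
    φ₁i≡φ₁j : φ₁ i ≡ φ₁ (punchIn i j)
    φ₁i≡φ₁j = move-sameComp-colour mv (step here i~j φi≡φj)

open Contraction using (floods-contract)

toℕ-punchIn-suc : ∀ (x : Fin n) → toℕ (punchIn (Fin.suc x) x) ≡ toℕ x
toℕ-punchIn-suc Fin.zero = refl
toℕ-punchIn-suc (Fin.suc x) = cong suc (toℕ-punchIn-suc x)

neighbour : (i : Fin (suc (suc n))) → ∃ λ j → PathAdj i (punchIn i j)
neighbour Fin.zero = Fin.zero , inj₁ refl
neighbour (Fin.suc i) = i , inj₂ (cong suc (toℕ-punchIn-suc i))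

floods-deleteVertex : (ω : Colouring (suc n) k) (i : Fin (suc n)) →
  Floods ω d t → ∃ λ t' → t' ≤ t × Floods (deleteVertex ω i) d t'
-- On the empty path no move can be played, so t' = t is impossible there when t > 0.
floods-deleteVertex {zero} ω i _ = 0 , z≤n , deleteVertex ω i , done , λ ()
floods-deleteVertex {suc n} {t = t} ω i flooded with neighbour i
... | (j , i~j) =
  t , ≤-refl , floods-anchored agree (floods-contract i j i~j ω'i≡ω'j (floods-anchored anchored flooded))
  where
  ω' : Colouring (suc (suc n)) _
  ω' = updateAt ω i (const (ω (punchIn i j)))
  ω'-elsewhere : ∀ {x} → x ≢ i → ω' x ≡ ω x
  ω'-elsewhere {x} x≢i = updateAt-minimal x i ω x≢i
  ω'i≡ω'j : ω' i ≡ ω' (punchIn i j)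
  ω'i≡ω'j = trans (updateAt-updates i ω) (sym (ω'-elsewhere (punchInᵢ≢i i j)))
  anchored : Anchored ω ω'
  anchored x with x ≟ᶠ i
  ... | yes refl = punchIn i j , step here i~j ω'i≡ω'j , ω'-elsewhere (punchInᵢ≢i i j)
  ... | no x≢i = x , here , ω'-elsewhere x≢i
  agree : Anchored (deleteVertex ω' i) (deleteVertex ω i)
  agree x = x , here , sym (ω'-elsewhere (punchInᵢ≢i i x))

lemma4p1 : ∀ {n k : ℕ} (ω : Colouring (suc n) k) (i : Fin (suc n)) →
    (∀ (d : Fin k) (m m' : ℕ) → IsMinD ω d m → IsMinD (deleteVertex ω i) d m' → m' ≤ m)
    × (∀ (m m' : ℕ) → IsMin ω m → IsMin (deleteVertex ω i) m' → m' ≤ m)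
lemma4p1 ω i = (λ d m m' (flooded , _) (_ , optimal) → bound flooded optimal)
             , (λ m m' ((d , flooded) , _) (_ , optimal) → bound flooded (optimal d))
  where
  bound : ∀ {d m m'} → Floods ω d m → (∀ t → Floods (deleteVertex ω i) d t → m' ≤ t) → m' ≤ m
  bound flooded optimal with floods-deleteVertex ω i flooded
  ... | (t' , t'≤m , flooded') = ≤-trans (optimal t' flooded') t'≤m
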